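{- Let $n\ge 1$, let $P_n$ be the path with $n$ vertices, and let $H$ be any dispersable bipartite graph. Then $P_n+_Q H$ is dispersable, i.e. $\operatorname{mbt}(P_n+_Q H)=\Delta(P_n+_Q H)$.
   Context: Matching book embedding: the vertices are placed in a linear order along a spine and each edge is assigned to a page (half-plane bounded by the spine) so that no two edges on the same page cross and every vertex is incident with at most one edge on each page. $\operatorname{mbt}(G)$ is the minimum number of pages of a matching book embedding of $G$. $G$ is dispersable if $\operatorname{mbt}(G)=\Delta(G)$, where $\Delta$ denotes maximum degree. For a graph $G$, $Q(G)$ is obtained by inserting a new vertex into each edge of $G$ and then joining two new vertices whenever their edges of $G$ share an endpoint; thus $V(Q(G))=V(G)\cup E(G)$. The $Q$-sum $G+_Q H$ has vertex set $(V(G)\cup E(G))\times V(H)$. Two vertices $(u_1,u_2)$ and $(v_1,v_2)$ are adjacent if and only if either $u_1=v_1\in V(G)$ and $u_2v_2\in E(H)$, or $u_2=v_2$ and $u_1v_1\in E(Q(G))$. -}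

module Defs where

open import Data.Nat using (ℕ; zero; suc; _+_; _*_; _≤_; _<_; _⊔_; _≡ᵇ_; _<ᵇ_)
open import Data.Bool using (Bool; true; false; _∧_; _∨_; not)
open import Data.Fin using (Fin; toℕ; splitAt; remQuot) renaming (_≟_ to _≟ᶠ_)
open import Data.List using (List; length; map; foldr; allFin; filterᵇ; cartesianProduct; lookup)
open import Data.Product using (_×_; _,_; Σ; ∃; proj₁; proj₂)
open import Data.Sum using (_⊎_; inj₁; inj₂)
open import Relation.Nullary using (¬_)
open import Relation.Nullary.Decidable using (⌊_⌋)
open import Relation.Binary.PropositionalEquality using (_≡_; _≢_)

record Graph : Set where
  field
    n   : ℕ
    adj : Fin n → Fin n → Bool
open Graph public

IsSimple : Graph → Set
IsSimple G = (∀ u v → adj G u v ≡ adj G v u) × (∀ v → adj G v v ≡ false)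

Edge : (G : Graph) → Fin (n G) → Fin (n G) → Set
Edge G u v = adj G u v ≡ true

deg : (G : Graph) → Fin (n G) → ℕ
deg G v = length (filterᵇ (adj G v) (allFin (n G)))

Δ : Graph → ℕ
Δ G = foldr _⊔_ 0 (map (deg G) (allFin (n G)))

IsBipartite : Graph → Set
IsBipartite G = Σ (Fin (n G) → Bool) λ c → ∀ u v → Edge G u v → c u ≢ c v

-- Matching book embeddings with k pages.
-- pos : injective placement of the vertices on the spine (a linear order);
-- page : page of each edge (only its values on edges matter).

record MBE (G : Graph) (k : ℕ) : Set where
  field
    pos      : Fin (n G) → ℕ
    pos-inj  : ∀ u v → pos u ≡ pos v → u ≡ v
    page     : Fin (n G) → Fin (n G) → Fin k
    page-sym : ∀ u v → Edge G u v → page u v ≡ page v u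
    matching : ∀ u v w → Edge G u v → Edge G u w → page u v ≡ page u w → v ≡ w
    noCross  : ∀ a b c d → Edge G a b → Edge G c d → page a b ≡ page c d →
               ¬ (pos a < pos c × pos c < pos b × pos b < pos d)

IsMbt : Graph → ℕ → Set
IsMbt G k = MBE G k × (∀ j → MBE G j → k ≤ j)

Dispersable : Graph → Set
Dispersable G = IsMbt G (Δ G)

Path : ℕ → Graph
Path m = record { n = m ; adj = λ i j → ((suc (toℕ i)) ≡ᵇ toℕ j) ∨ ((suc (toℕ j)) ≡ᵇ toℕ i) }

edgeList : (G : Graph) → List (Fin (n G) × Fin (n G))
edgeList G = filterᵇ (λ p → (toℕ (proj₁ p) <ᵇ toℕ (proj₂ p)) ∧ adj G (proj₁ p) (proj₂ p))
                     (cartesianProduct (allFin (n G)) (allFin (n G)))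

m : Graph → ℕ
m G = length (edgeList G)

ends : (G : Graph) → Fin (m G) → Fin (n G) × Fin (n G)
ends G e = lookup (edgeList G) e

_==_ : ∀ {k} → Fin k → Fin k → Bool
i == j = ⌊ i ≟ᶠ j ⌋

incident : (G : Graph) → Fin (n G) → Fin (m G) → Bool
incident G u e = (u == proj₁ (ends G e)) ∨ (u == proj₂ (ends G e))

adjQ : (G : Graph) → Fin (n G) ⊎ Fin (m G) → Fin (n G) ⊎ Fin (m G) → Bool
adjQ G (inj₁ u) (inj₁ v) = false
adjQ G (inj₁ u) (inj₂ e) = incident G u e
adjQ G (inj₂ e) (inj₁ u) = incident G u e
adjQ G (inj₂ e) (inj₂ f) =
  not (e == f) ∧ (incident G (proj₁ (ends G e)) f ∨ incident G (proj₂ (ends G e)) f)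

Q : Graph → Graph
Q G = record { n = n G + m G ; adj = λ x y → adjQ G (splitAt (n G) x) (splitAt (n G) y) }

-- Q-sum G +_Q H on (V(G) ∪ E(G)) × V(H), encoded as Fin ((n G + m G) * n H).
adjQSum : (G H : Graph) → (Fin (n G) ⊎ Fin (m G)) × Fin (n H) →
          (Fin (n G) ⊎ Fin (m G)) × Fin (n H) → Bool
adjQSum G H (inj₁ u₁ , u₂) (inj₁ v₁ , v₂) = ((u₁ == v₁) ∧ adj H u₂ v₂) ∨ ((u₂ == v₂) ∧ adjQ G (inj₁ u₁) (inj₁ v₁))
adjQSum G H (a , u₂) (b , v₂) = (u₂ == v₂) ∧ adjQ G a b

decode : (G H : Graph) → Fin ((n G + m G) * n H) → (Fin (n G) ⊎ Fin (m G)) × Fin (n H)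
decode G H x with remQuot (n H) x
... | a , i = splitAt (n G) a , i

_+Q_ : Graph → Graph → Graph
G +Q H = record { n = (n G + m G) * n H ; adj = λ x y → adjQSum G H (decode G H x) (decode G H y) }

-- The spine is cut into blocks, one for each vertex h of H in the order of the given embedding of H;
-- block h holds the copy (V(P_k) ∪ E(P_k)) × {h} of Q(P_k) in a fixed order, reversed when h has
-- colour true.  An edge (v,h)(v,g) goes to the page of hg (relabelled in one row when k = 2): two such
-- edges can only interleave if they join the same two blocks, and as h and g have different colours
-- these blocks are mirror images, so the edges are nested instead.  Inside a block Q(P_k) is drawn
-- without crossings: the zigzag v₀ e₀ v₁ e₁ … is a family of nested arcs and the edges e_j e_{j+1}
-- join neighbours.  So pages are needed only for the matching condition: two alternating pages for
-- the zigzag, which the H-edges in rows under it avoid, and two alternating pages for the e_j e_{j+1},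
-- which may be H-pages since no H-edge meets a vertex (e_j , h).  This uses max(Δ(H), 2) + 2 pages for
-- k ≥ 4, Δ(H) + 2 for k = 3, Δ(H) + 1 for k = 2 and Δ(H) for k = 1: the degree of (e₁,h) or (v₁,h),
-- of (v₁,h), (v₀,h) and (v₀,h) respectively, for h of maximal degree.  No embedding has fewer than
-- Δ pages.

module Submission where

open import Defs
open import Data.Bool using (Bool; true; false; T; T?; _∧_; _∨_; not)
open import Data.Bool.Properties using (T-≡; T-∧; T-∨; ∧-conicalˡ; ∧-conicalʳ; ∧-zeroʳ; ∨-identityʳ; ∨-zeroʳ)
open import Data.Empty using (⊥; ⊥-elim)
open import Data.Fin using (Fin; toℕ; fromℕ<; combine; remQuot; join; splitAt)
  renaming (zero to fzero; suc to fsuc; _≟_ to _≟ᶠ_)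
open import Data.Fin.Properties
  using (toℕ-injective; toℕ<n; toℕ-fromℕ<; injective⇒≤; remQuot-combine; combine-remQuot; splitAt-join; join-splitAt)
open import Data.List using (List; []; _∷_; _++_; length; map; allFin; filterᵇ; lookup; cartesianProduct)
open import Data.List.Properties using (foldr-preservesᵇ; foldr-preservesᵒ; length-map; length-++)
open import Data.List.Membership.Propositional using (_∈_)
open import Data.List.Membership.Propositional.Properties
  using (∈-filter⁺; ∈-filter⁻; ∈-allFin; ∈-lookup; ∈-map⁺; ∈-map⁻; ∈-cartesianProduct⁺)
open import Data.List.Relation.Unary.All as All using (All; []; _∷_)
import Data.List.Relation.Unary.All.Properties as All
import Data.List.Relation.Unary.Any as Any
open import Data.List.Relation.Unary.Any.Properties using (lookup-index)
open import Data.List.Relation.Unary.AllPairs using ([]; _∷_)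
open import Data.List.Relation.Unary.Unique.Propositional using (Unique)
open import Data.List.Relation.Unary.Unique.Propositional.Properties
  using (filter⁺; allFin⁺; cartesianProduct⁺; map⁺; ++⁺)
open import Data.Nat using (ℕ; zero; suc; _+_; _*_; _∸_; _≤_; _<_; _⊔_; _⊓_; z≤n; s≤s; _<ᵇ_; _≡ᵇ_)
open import Data.Nat.Properties
open import Data.Product using (_×_; _,_; ∃; proj₁; proj₂)
import Data.Product as Product
open import Data.Sum using (_⊎_; inj₁; inj₂; [_,_]′)
import Data.Sum as Sum
open import Function using (_∘_; Injective)
open import Function.Bundles using (Equivalence)
open import Relation.Nullary using (¬_; yes; no)
open import Relation.Binary.PropositionalEquality using (_≡_; _≢_; refl; sym; trans; cong; cong₂; subst)

T⇒≡true : ∀ {b} → T b → b ≡ true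
T⇒≡true = Equivalence.to T-≡

≡true⇒T : ∀ {b} → b ≡ true → T b
≡true⇒T = Equivalence.from T-≡

≡⇒==true : ∀ {k} {i j : Fin k} → i ≡ j → (i == j) ≡ true
≡⇒==true {i = i} {j} i≡j with i ≟ᶠ j
... | yes _ = refl
... | no i≢j = ⊥-elim (i≢j i≡j)

==true⇒≡ : ∀ {k} {i j : Fin k} → (i == j) ≡ true → i ≡ j
==true⇒≡ {i = i} {j} _ with i ≟ᶠ j
... | yes i≡j = i≡j

≢⇒==false : ∀ {k} {i j : Fin k} → i ≢ j → (i == j) ≡ false
≢⇒==false {i = i} {j} i≢j with i ≟ᶠ j
... | yes i≡j = ⊥-elim (i≢j i≡j)
... | no _ = refl

not==true⇒≢ : ∀ {k} {i j : Fin k} → not (i == j) ≡ true → i ≢ j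
not==true⇒≢ {i = i} x refl with subst (λ b → not b ≡ true) (≡⇒==true {i = i} refl) x
... | ()

∨-true⁻ : ∀ {a b} → a ∨ b ≡ true → a ≡ true ⊎ b ≡ true
∨-true⁻ {true} _ = inj₁ refl
∨-true⁻ {false} b≡true = inj₂ b≡true

lookup-injective : ∀ {A : Set} {xs : List A} → Unique xs → ∀ {i j} → lookup xs i ≡ lookup xs j → i ≡ j
lookup-injective (_ ∷ _) {fzero} {fzero} _ = refl
lookup-injective (x∉xs ∷ _) {fzero} {fsuc j} eq = ⊥-elim (All.lookup x∉xs (∈-lookup j) eq)
lookup-injective (x∉xs ∷ _) {fsuc i} {fzero} eq = ⊥-elim (All.lookup x∉xs (∈-lookup i) (sym eq))
lookup-injective (_ ∷ xs!) {fsuc i} {fsuc j} eq = cong fsuc (lookup-injective xs! eq)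

neighbours : (G : Graph) → Fin (n G) → List (Fin (n G))
neighbours G x = filterᵇ (adj G x) (allFin (n G))

module _ (G : Graph) (x : Fin (n G)) where

  neighbours-unique : Unique (neighbours G x)
  neighbours-unique = filter⁺ (T? ∘ adj G x) (allFin⁺ (n G))

  ∈-neighbours⁻ : ∀ {y} → y ∈ neighbours G x → Edge G x y
  ∈-neighbours⁻ y∈ = T⇒≡true (proj₂ (∈-filter⁻ (T? ∘ adj G x) {xs = allFin (n G)} y∈))

  ∈-neighbours⁺ : ∀ {y} → Edge G x y → y ∈ neighbours G x
  ∈-neighbours⁺ {y} xy = ∈-filter⁺ (T? ∘ adj G x) (∈-allFin y) (≡true⇒T xy)

  deg≤pages : ∀ {p} → MBE G p → deg G x ≤ p
  deg≤pages E = injective⇒≤ page-injective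
    where
    open MBE E
    neighbour : Fin (deg G x) → Fin (n G)
    neighbour = lookup (neighbours G x)
    adjacent : ∀ t → Edge G x (neighbour t)
    adjacent t = ∈-neighbours⁻ (∈-lookup t)
    page-injective : Injective _≡_ _≡_ (λ t → page x (neighbour t))
    page-injective {s} {t} eq = lookup-injective neighbours-unique (matching x _ _ (adjacent s) (adjacent t) eq)

  ≤deg : ∀ {ys} → Unique ys → All (Edge G x) ys → length ys ≤ deg G x
  ≤deg {ys} ys! edges = injective⇒≤ index-injective
    where
    membership : ∀ i → lookup ys i ∈ neighbours G x
    membership i = ∈-neighbours⁺ (All.lookup edges (∈-lookup i))
    index-injective : Injective _≡_ _≡_ (λ i → Any.index (membership i))
    index-injective {i} {j} eq = lookup-injective ys!
      (trans (lookup-index (membership i)) (trans (cong (lookup (neighbours G x)) eq) (sym (lookup-index (membership j)))))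

  deg≤Δ : deg G x ≤ Δ G
  deg≤Δ = foldr-preservesᵒ {P = deg G x ≤_} ⊔-grows 0 (map (deg G) (allFin (n G)))
            (inj₂ (Any.map (λ { refl → ≤-refl }) (∈-map⁺ (deg G) (∈-allFin x))))
    where
    ⊔-grows : ∀ a b → deg G x ≤ a ⊎ deg G x ≤ b → deg G x ≤ a ⊔ b
    ⊔-grows a b = [ (λ p → ≤-trans p (m≤m⊔n a b)) , (λ p → ≤-trans p (m≤n⊔m a b)) ]′

  Δ-attained : ∃ λ y → Δ G ≤ deg G y
  Δ-attained = foldr-preservesᵇ {P = λ a → ∃ λ y → a ≤ deg G y} ⊔-attained (x , z≤n)
                 (All.map⁺ (All.universal (λ y → y , ≤-refl) (allFin (n G))))
    where
    ⊔-attained : ∀ {a b} → ∃ (λ y → a ≤ deg G y) → ∃ (λ y → b ≤ deg G y) → ∃ (λ y → a ⊔ b ≤ deg G y)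
    ⊔-attained {a} {b} (y , a≤) (z , b≤) with ⊔-sel a b
    ... | inj₁ eq = y , subst (_≤ deg G y) (sym eq) a≤
    ... | inj₂ eq = z , subst (_≤ deg G z) (sym eq) b≤

Δ≤pages : ∀ G {p} → MBE G p → Δ G ≤ p
Δ≤pages G {p} E =
  foldr-preservesᵇ {P = _≤ p} ⊔-lub z≤n (All.map⁺ (All.universal (λ x → deg≤pages G x E) (allFin (n G))))

dispersable : ∀ G {p} → MBE G p → p ≤ Δ G → Dispersable G
dispersable G E p≤Δ = subst (MBE G) (≤-antisym p≤Δ (Δ≤pages G E)) E , λ _ → Δ≤pages G

dispersable-empty : ∀ G → ¬ Fin (n G) → Dispersable G
dispersable-empty G none = embedding , λ _ → Δ≤pages G
  where
  embedding : MBE G (Δ G)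
  embedding = record
    { pos = absurd ; pos-inj = λ u → absurd u ; page = absurd ; page-sym = λ u → absurd u
    ; matching = λ u → absurd u ; noCross = λ a → absurd a }
    where
    absurd : ∀ {A : Set} → Fin (n G) → A
    absurd x = ⊥-elim (none x)

module _ {G : Graph} (simple : IsSimple G) {p} (E : MBE G p) where
  open MBE E

  private
    flip-edge : ∀ {u v} → Edge G u v → Edge G v u
    flip-edge {u} {v} uv = trans (proj₁ simple v u) uv

    no-loop : ∀ {u} → ¬ Edge G u u
    no-loop {u} uu with trans (sym uu) (proj₂ simple u)
    ... | ()

    pos-< : ∀ {u v} → u ≢ v → pos u ≤ pos v → pos u < pos v
    pos-< u≢v u≤v = ≤∧≢⇒< u≤v (u≢v ∘ pos-inj _ _)

  interleaved⇒same-edge : ∀ {h g h' g'} → Edge G h g → Edge G h' g' → page h g ≡ page h' g' →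
                          pos h ≤ pos h' → pos h' ≤ pos g → pos g ≤ pos g' → h ≡ h' × g ≡ g'
  interleaved⇒same-edge {h} {g} {h'} {g'} hg h'g' same h≤h' h'≤g g≤g' with h ≟ᶠ h'
  ... | yes refl = refl , matching h g g' hg h'g' same
  ... | no h≢h' with g ≟ᶠ g'
  ...   | yes refl = ⊥-elim (h≢h' (matching g h h' (flip-edge hg) (flip-edge h'g')
                       (trans (sym (page-sym h g hg)) (trans same (page-sym h' g h'g')))))
  ...   | no g≢g' with h' ≟ᶠ g
  ...     | no h'≢g = ⊥-elim (noCross h g h' g' hg h'g' same (pos-< h≢h' h≤h' , pos-< h'≢g h'≤g , pos-< g≢g' g≤g'))
  ...     | yes refl with matching g h g' (flip-edge hg) h'g' (trans (sym (page-sym h g hg)) same)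
  ...       | refl = ⊥-elim (no-loop (subst (Edge G h) (pos-inj g h (≤-antisym g≤g' h≤h')) hg))

module PathQ (k : ℕ) where

  PEdge : Set
  PEdge = Fin (m (Path k))

  Cell : Set
  Cell = Fin k ⊎ PEdge

  lo : PEdge → ℕ
  lo e = toℕ (proj₁ (ends (Path k) e))

  private
    isPathEdge : Fin k × Fin k → Bool
    isPathEdge p = (toℕ (proj₁ p) <ᵇ toℕ (proj₂ p)) ∧ adj (Path k) (proj₁ p) (proj₂ p)

    pairs : List (Fin k × Fin k)
    pairs = cartesianProduct (allFin k) (allFin k)

    edgeList-unique : Unique (edgeList (Path k))
    edgeList-unique = filter⁺ (T? ∘ isPathEdge) (cartesianProduct⁺ (allFin⁺ k) (allFin⁺ k))

    consecutive : ∀ x y → T ((x <ᵇ y) ∧ ((suc x ≡ᵇ y) ∨ (suc y ≡ᵇ x))) → y ≡ suc x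
    consecutive x y on-path with Equivalence.to T-∧ on-path
    ... | x<y , adjacent with Equivalence.to T-∨ adjacent
    ...   | inj₁ 1+x≡y = sym (≡ᵇ⇒≡ (suc x) y 1+x≡y)
    ...   | inj₂ 1+y≡x = ⊥-elim (<-asym (<ᵇ⇒< x y x<y) (≤-reflexive (≡ᵇ⇒≡ (suc y) x 1+y≡x)))

  hi≡suc-lo : ∀ e → toℕ (proj₂ (ends (Path k) e)) ≡ suc (lo e)
  hi≡suc-lo e = consecutive _ _ (proj₂ (∈-filter⁻ (T? ∘ isPathEdge) {xs = pairs} (∈-lookup e)))

  lo+2≤k : ∀ e → 2 + lo e ≤ k
  lo+2≤k e = subst (_≤ k) (cong suc (hi≡suc-lo e)) (toℕ<n (proj₂ (ends (Path k) e)))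

  lo-injective : ∀ {e f} → lo e ≡ lo f → e ≡ f
  lo-injective {e} {f} eq = lookup-injective edgeList-unique
    (cong₂ _,_ (toℕ-injective eq) (toℕ-injective (trans (hi≡suc-lo e) (trans (cong suc eq) (sym (hi≡suc-lo f))))))

  edge-at : ∀ {j} → 2 + j ≤ k → ∃ λ e → lo e ≡ j
  edge-at {j} 2+j≤k = Any.index member , trans (cong (toℕ ∘ proj₁) (sym (lookup-index member))) (toℕ-fromℕ< j<k)
    where
    j<k : j < k
    j<k = ≤-trans (n≤1+n _) 2+j≤k
    u v : Fin k
    u = fromℕ< j<k
    v = fromℕ< 2+j≤k
    on-path : T (isPathEdge (u , v))
    on-path rewrite toℕ-fromℕ< j<k | toℕ-fromℕ< 2+j≤k =
      Equivalence.from T-∧ (<⇒<ᵇ (n<1+n j) , Equivalence.from T-∨ (inj₁ (≡⇒≡ᵇ (suc j) (suc j) refl)))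
    member : (u , v) ∈ edgeList (Path k)
    member = ∈-filter⁺ (T? ∘ isPathEdge) (∈-cartesianProduct⁺ (∈-allFin u) (∈-allFin v)) on-path

  data Incident (u : Fin k) (e : PEdge) : Set where
    lower : toℕ u ≡ lo e → Incident u e
    upper : toℕ u ≡ suc (lo e) → Incident u e

  incident⇒Incident : ∀ {u e} → incident (Path k) u e ≡ true → Incident u e
  incident⇒Incident {e = e} x with ∨-true⁻ x
  ... | inj₁ u=lo = lower (cong toℕ (==true⇒≡ u=lo))
  ... | inj₂ u=hi = upper (trans (cong toℕ (==true⇒≡ u=hi)) (hi≡suc-lo e))

  Incident⇒incident : ∀ {u e} → Incident u e → incident (Path k) u e ≡ true
  Incident⇒incident {u} {e} (lower u≡lo) = cong (_∨ (u == proj₂ (ends (Path k) e))) (≡⇒==true (toℕ-injective u≡lo))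
  Incident⇒incident {u} {e} (upper u≡hi) =
    trans (cong ((u == proj₁ (ends (Path k) e)) ∨_) (≡⇒==true (toℕ-injective (trans u≡hi (sym (hi≡suc-lo e))))))
          (∨-zeroʳ _)

  data QEdge : Cell → Cell → Set where
    vertex-edge : ∀ {u e} → Incident u e → QEdge (inj₁ u) (inj₂ e)
    edge-vertex : ∀ {u e} → Incident u e → QEdge (inj₂ e) (inj₁ u)
    edge-next : ∀ {e f} → lo f ≡ suc (lo e) → QEdge (inj₂ e) (inj₂ f)
    edge-prev : ∀ {e f} → lo e ≡ suc (lo f) → QEdge (inj₂ e) (inj₂ f)

  adjQ⇒QEdge : ∀ a b → adjQ (Path k) a b ≡ true → QEdge a b
  adjQ⇒QEdge (inj₁ u) (inj₂ e) x = vertex-edge (incident⇒Incident x)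
  adjQ⇒QEdge (inj₂ e) (inj₁ u) x = edge-vertex (incident⇒Incident x)
  adjQ⇒QEdge (inj₂ e) (inj₂ f) x with ∨-true⁻ (∧-conicalʳ _ _ x)
  ... | inj₁ lo-end∈f with incident⇒Incident lo-end∈f
  ...   | lower lo≡lo = ⊥-elim (e≢f (lo-injective lo≡lo))
    where e≢f = not==true⇒≢ (∧-conicalˡ _ _ x)
  ...   | upper lo≡suc = edge-prev lo≡suc
  adjQ⇒QEdge (inj₂ e) (inj₂ f) x | inj₂ hi-end∈f with incident⇒Incident hi-end∈f
  ...   | lower hi≡lo = edge-next (trans (sym hi≡lo) (hi≡suc-lo e))
  ...   | upper hi≡suc = ⊥-elim (e≢f (lo-injective (suc-injective (trans (sym (hi≡suc-lo e)) hi≡suc))))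
    where e≢f = not==true⇒≢ (∧-conicalˡ _ _ x)

  QEdge⇒adjQ : ∀ {a b} → QEdge a b → adjQ (Path k) a b ≡ true
  QEdge⇒adjQ (vertex-edge u∈e) = Incident⇒incident u∈e
  QEdge⇒adjQ (edge-vertex u∈e) = Incident⇒incident u∈e
  QEdge⇒adjQ (edge-next {e} {f} next)
    rewrite ≢⇒==false {i = e} {f} (λ { refl → 1+n≢n (sym next) }) =
    trans (cong (incident (Path k) (proj₁ (ends (Path k) e)) f ∨_) (Incident⇒incident (lower (trans (hi≡suc-lo e) (sym next)))))
          (∨-zeroʳ _)
  QEdge⇒adjQ (edge-prev {e} {f} prev)
    rewrite ≢⇒==false {i = e} {f} (λ { refl → 1+n≢n (sym prev) }) =
    cong (_∨ incident (Path k) (proj₂ (ends (Path k) e)) f) (Incident⇒incident (upper prev))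

module QSum (k : ℕ) (H : Graph) where
  open PathQ k

  G : Graph
  G = Path k +Q H

  S : Set
  S = Cell × Fin (n H)

  decodeS : Fin (n G) → S
  decodeS = decode (Path k) H

  encode : S → Fin (n G)
  encode (a , h) = combine (join k (m (Path k)) a) h

  decode-encode : ∀ s → decodeS (encode s) ≡ s
  decode-encode (a , h) =
    trans (cong (λ qr → splitAt k (proj₁ qr) , proj₂ qr) (remQuot-combine {k + m (Path k)} {n H} (join k (m (Path k)) a) h))
          (cong (_, h) (splitAt-join k (m (Path k)) a))

  encode-decode : ∀ x → encode (decodeS x) ≡ x
  encode-decode x = trans (cong (λ i → combine i (proj₂ qr)) (join-splitAt k (m (Path k)) (proj₁ qr)))
                          (combine-remQuot {k + m (Path k)} (n H) x)
    where qr = remQuot {k + m (Path k)} (n H) x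

  decode-injective : ∀ {x y} → decodeS x ≡ decodeS y → x ≡ y
  decode-injective {x} {y} eq = trans (sym (encode-decode x)) (trans (cong encode eq) (encode-decode y))

  data Link : S → S → Set where
    row : ∀ u {h g} → Edge H h g → Link (inj₁ u , h) (inj₁ u , g)
    column : ∀ h {a b} → QEdge a b → Link (a , h) (b , h)

  private
    column⁺ : ∀ a b {h g} → (h == g) ∧ adjQ (Path k) a b ≡ true → Link (a , h) (b , g)
    column⁺ a b {h} {g} x with refl ← ==true⇒≡ {i = h} {g} (∧-conicalˡ _ _ x) =
      column h (adjQ⇒QEdge a b (∧-conicalʳ _ _ x))

    column⁻ : ∀ {a b} (h : Fin (n H)) → QEdge a b → (h == h) ∧ adjQ (Path k) a b ≡ true
    column⁻ h q = cong₂ _∧_ (≡⇒==true {i = h} refl) (QEdge⇒adjQ q)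

  adjQSum⇒Link : ∀ s t → adjQSum (Path k) H s t ≡ true → Link s t
  adjQSum⇒Link (inj₁ u , h) (inj₁ v , g) x
    rewrite ∧-zeroʳ (h == g) | ∨-identityʳ ((u == v) ∧ adj H h g)
    with refl ← ==true⇒≡ (∧-conicalˡ (u == v) _ x) = row u (∧-conicalʳ _ _ x)
  adjQSum⇒Link (inj₁ u , h) (inj₂ e , g) x = column⁺ (inj₁ u) (inj₂ e) x
  adjQSum⇒Link (inj₂ e , h) (b , g) x = column⁺ (inj₂ e) b x

  Link⇒adjQSum : ∀ {s t} → Link s t → adjQSum (Path k) H s t ≡ true
  Link⇒adjQSum (row u {h} {g} hg) = cong (_∨ ((h == g) ∧ false)) (cong₂ _∧_ (≡⇒==true {i = u} refl) hg)
  Link⇒adjQSum (column h q@(vertex-edge _)) = column⁻ h q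
  Link⇒adjQSum (column h q@(edge-vertex _)) = column⁻ h q
  Link⇒adjQSum (column h q@(edge-next _)) = column⁻ h q
  Link⇒adjQSum (column h q@(edge-prev _)) = column⁻ h q

  Edge⇒Link : ∀ {x y} → Edge G x y → Link (decodeS x) (decodeS y)
  Edge⇒Link {x} {y} = adjQSum⇒Link (decodeS x) (decodeS y)

  Link⇒Edge : ∀ {s t} → Link s t → Edge G (encode s) (encode t)
  Link⇒Edge {s} {t} l rewrite decode-encode s | decode-encode t = Link⇒adjQSum l

Between : ℕ → ℕ → ℕ → Set
Between x z y = (x < z × z < y) ⊎ (y < z × z < x)

Between-sym : ∀ {x z y} → Between x z y → Between y z x
Between-sym = Sum.swap

adjacent-empty : ∀ {x y z} → x ≡ suc y ⊎ y ≡ suc x → ¬ Between x z y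
adjacent-empty (inj₁ refl) (inj₁ (x<z , z<y)) = <-asym x<z (<-trans z<y (n<1+n _))
adjacent-empty (inj₁ refl) (inj₂ (y<z , z<x)) = <⇒≱ z<x y<z
adjacent-empty (inj₂ refl) (inj₁ (x<z , z<y)) = <⇒≱ z<y x<z
adjacent-empty (inj₂ refl) (inj₂ (y<z , z<x)) = <-asym y<z (<-trans z<x (n<1+n _))

module ColumnLayout (k : ℕ) where
  open PathQ k

  K : ℕ
  K = k + k

  -- Column order v₁ … v_{k-1} e_{k-2} … e₀ v₀; with v₀ last, no row lies under the edge v₀e₀.
  vertexOffset : ℕ → ℕ
  vertexOffset zero = suc K
  vertexOffset (suc i) = suc i

  offset : Cell → ℕ
  offset (inj₁ u) = vertexOffset (toℕ u)
  offset (inj₂ e) = K ∸ lo e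

  k≤K∸j : ∀ {j} → j ≤ k → k ≤ K ∸ j
  k≤K∸j {j} j≤k = subst (_≤ K ∸ j) (m+n∸n≡m k k) (∸-monoʳ-≤ K j≤k)

  lo≤k : ∀ e → lo e ≤ k
  lo≤k e = ≤-trans (n≤1+n _) (≤-trans (n≤1+n _) (lo+2≤k e))

  offset≤1+K : ∀ a → offset a ≤ suc K
  offset≤1+K (inj₁ u) with toℕ u | toℕ<n u
  ... | zero | _ = ≤-refl
  ... | suc i | i<k = ≤-trans (<⇒≤ i<k) (≤-trans (m≤m+n k k) (n≤1+n K))
  offset≤1+K (inj₂ e) = ≤-trans (m∸n≤m K (lo e)) (n≤1+n K)

  private
    1+j<K : ∀ {j} → suc j < k → j < K
    1+j<K j<k = ≤-trans (<⇒≤ j<k) (m≤m+n k k)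

    vertex≢edge : ∀ {i j} → i < k → j ≤ k → vertexOffset i ≢ K ∸ j
    vertex≢edge {zero} {j} _ _ eq = <⇒≱ (n<1+n K) (subst (_≤ K) (sym eq) (m∸n≤m K j))
    vertex≢edge {suc i} i<k j≤k eq = <⇒≱ i<k (subst (k ≤_) (sym eq) (k≤K∸j j≤k))

    vertexOffset-injective : ∀ {i j} → i < k → j < k → vertexOffset i ≡ vertexOffset j → i ≡ j
    vertexOffset-injective {zero} {zero} _ _ _ = refl
    vertexOffset-injective {zero} {suc j} _ j<k eq = ⊥-elim (<-irrefl (suc-injective (sym eq)) (1+j<K j<k))
    vertexOffset-injective {suc i} {zero} i<k _ eq = ⊥-elim (<-irrefl (suc-injective eq) (1+j<K i<k))
    vertexOffset-injective {suc i} {suc j} _ _ eq = eq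

  offset-injective : ∀ {a b} → offset a ≡ offset b → a ≡ b
  offset-injective {inj₁ u} {inj₁ v} eq = cong inj₁ (toℕ-injective (vertexOffset-injective (toℕ<n u) (toℕ<n v) eq))
  offset-injective {inj₁ u} {inj₂ e} eq = ⊥-elim (vertex≢edge (toℕ<n u) (lo≤k e) eq)
  offset-injective {inj₂ e} {inj₁ u} eq = ⊥-elim (vertex≢edge (toℕ<n u) (lo≤k e) (sym eq))
  offset-injective {inj₂ e} {inj₂ f} eq =
    cong inj₂ (lo-injective (∸-cancelˡ-≡ (≤-trans (lo≤k e) (m≤m+n k k)) (≤-trans (lo≤k f) (m≤m+n k k)) eq))

  -- A column edge either joins consecutive offsets or has offsets {i , K ∸ j}, where i + j is
  -- its index along the zigzag v₀ e₀ v₁ e₁ v₂ …; crossing edges would need each index below the other.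
  data Span (x y : ℕ) : Set where
    short : x ≡ suc y ⊎ y ≡ suc x → Span x y
    long : ∀ i j → j ≤ i → i ≤ suc j → 2 + j ≤ k → (x ≡ i × y ≡ K ∸ j) ⊎ (x ≡ K ∸ j × y ≡ i) → Span x y

  Span-sym : ∀ {x y} → Span x y → Span y x
  Span-sym (short adjacent) = short (Sum.swap adjacent)
  Span-sym (long i j j≤i i≤j+1 bound ends) =
    long i j j≤i i≤j+1 bound (Sum.swap (Sum.map Product.swap Product.swap ends))

  private
    i<K∸j : ∀ {i j} → i ≤ suc j → 2 + j ≤ k → i < K ∸ j
    i<K∸j i≤j+1 bound = <-≤-trans (s≤s i≤j+1) (≤-trans bound (k≤K∸j (≤-trans (n≤1+n _) (≤-trans (n≤1+n _) bound))))

    inside-long : ∀ {i j z} → i ≤ suc j → 2 + j ≤ k → Between i z (K ∸ j) → i < z × z < K ∸ j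
    inside-long _ _ (inj₁ inside) = inside
    inside-long i≤j+1 bound (inj₂ (K∸j<z , z<i)) = ⊥-elim (<-asym (i<K∸j i≤j+1 bound) (<-trans K∸j<z z<i))

    nested : ∀ {i j i' j' z} → j ≤ i → i ≤ suc j → 2 + j ≤ k → j' ≤ i' → i' ≤ suc j' →
             Between i z (K ∸ j) → z ≡ i' ⊎ z ≡ K ∸ j' → i + j < i' + j'
    nested {i} {j} {i'} {j'} j≤i i≤j+1 bound j'≤i' i'≤j'+1 inside z-end with inside-long i≤j+1 bound inside | z-end
    ... | i<z , _ | inj₁ refl = +-mono-<-≤ i<z (≤-trans j≤i (≤-pred (<-≤-trans i<z i'≤j'+1)))
    ... | _ , z<K∸j | inj₂ refl = +-mono-≤-< (≤-trans i≤j+1 (≤-trans j<j' j'≤i')) j<j'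
      where
      j<j' : j < j'
      j<j' = ≰⇒> (λ j'≤j → <⇒≱ z<K∸j (∸-monoʳ-≤ K j'≤j))

    normalise : ∀ {x y z i j} → (x ≡ i × y ≡ K ∸ j) ⊎ (x ≡ K ∸ j × y ≡ i) → Between x z y → Between i z (K ∸ j)
    normalise (inj₁ (refl , refl)) inside = inside
    normalise (inj₂ (refl , refl)) inside = Between-sym inside

    first-end : ∀ {x y i j} → (x ≡ i × y ≡ K ∸ j) ⊎ (x ≡ K ∸ j × y ≡ i) → x ≡ i ⊎ x ≡ K ∸ j
    first-end = Sum.map proj₁ proj₁

    second-end : ∀ {x y i j} → (x ≡ i × y ≡ K ∸ j) ⊎ (x ≡ K ∸ j × y ≡ i) → y ≡ i ⊎ y ≡ K ∸ j
    second-end = Sum.swap ∘ Sum.map proj₂ proj₂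

  spans-noncrossing : ∀ {x y x' y'} → Span x y → Span x' y' → Between x x' y → Between x' y y' → ⊥
  spans-noncrossing (short adjacent) _ x'-inside _ = adjacent-empty adjacent x'-inside
  spans-noncrossing (long _ _ _ _ _ _) (short adjacent') _ y-inside = adjacent-empty adjacent' y-inside
  spans-noncrossing (long i j j≤i i≤j+1 bound ends) (long i' j' j'≤i' i'≤j'+1 bound' ends') x'-inside y-inside =
    <-asym (nested j≤i i≤j+1 bound j'≤i' i'≤j'+1 (normalise {j = j} ends x'-inside) (first-end {j = j'} ends'))
           (nested j'≤i' i'≤j'+1 bound' j≤i i≤j+1 (normalise {j = j'} ends' y-inside) (second-end {j = j} ends))

  next-adjacent : ∀ {e f} → lo f ≡ suc (lo e) → K ∸ lo e ≡ suc (K ∸ lo f)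
  next-adjacent {e} next =
    trans (+-∸-assoc 1 (≤-trans (n≤1+n _) (≤-trans (lo+2≤k e) (m≤m+n k k)))) (cong (λ j → suc (K ∸ j)) (sym next))

  private
    vertex-edge-span : ∀ {i j} → i ≡ j ⊎ i ≡ suc j → 2 + j ≤ k → Span (vertexOffset i) (K ∸ j)
    vertex-edge-span {zero} (inj₁ refl) _ = short (inj₁ refl)
    vertex-edge-span {suc i} (inj₁ refl) bound = long (suc i) (suc i) ≤-refl (n≤1+n _) bound (inj₁ (refl , refl))
    vertex-edge-span {suc i} (inj₂ refl) bound = long (suc i) i (n≤1+n i) ≤-refl bound (inj₁ (refl , refl))

    incidence-span : ∀ {u e} → Incident u e → Span (vertexOffset (toℕ u)) (K ∸ lo e)
    incidence-span (lower u≡lo) = vertex-edge-span (inj₁ u≡lo) (lo+2≤k _)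
    incidence-span (upper u≡hi) = vertex-edge-span (inj₂ u≡hi) (lo+2≤k _)

  span : ∀ {a b} → QEdge a b → Span (offset a) (offset b)
  span (vertex-edge u∈e) = incidence-span u∈e
  span (edge-vertex u∈e) = Span-sym (incidence-span u∈e)
  span (edge-next next) = short (inj₁ (next-adjacent next))
  span (edge-prev prev) = short (inj₂ (next-adjacent prev))

  row-inside-zigzag : ∀ {i j r} → i ≤ suc j → 2 + j ≤ k → r < k →
                      Between (vertexOffset i) (vertexOffset r) (K ∸ j) → 1 ≤ i × i < r
  row-inside-zigzag {zero} {j} {zero} _ _ _ (inj₁ (K<K , _)) = ⊥-elim (<-irrefl refl K<K)
  row-inside-zigzag {zero} {j} {zero} _ _ _ (inj₂ (_ , K<K)) = ⊥-elim (<-irrefl refl K<K)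
  row-inside-zigzag {zero} {j} {suc r} _ _ r<k (inj₁ (K<r , _)) =
    ⊥-elim (<⇒≱ K<r (≤-trans (<⇒≤ r<k) (≤-trans (m≤m+n k k) (n≤1+n K))))
  row-inside-zigzag {zero} {j} {suc r} _ bound r<k (inj₂ (K∸j<r , _)) =
    ⊥-elim (<⇒≱ K∸j<r (≤-trans (<⇒≤ r<k) (k≤K∸j (≤-trans (n≤1+n _) (≤-trans (n≤1+n _) bound)))))
  row-inside-zigzag {suc i} {j} {zero} i≤j+1 bound _ inside =
    ⊥-elim (<⇒≱ (proj₂ (inside-long i≤j+1 bound inside)) (≤-trans (m∸n≤m K j) (n≤1+n K)))
  row-inside-zigzag {suc i} {j} {suc r} i≤j+1 bound _ inside = s≤s z≤n , proj₁ (inside-long i≤j+1 bound inside)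

lex-< : ∀ {B b b' r r'} → b < b' → r < B → b * B + r < b' * B + r'
lex-< {B} {b} {b'} {r} {r'} b<b' r<B = begin-strict
  b * B + r   <⟨ +-monoʳ-< (b * B) r<B ⟩
  b * B + B   ≡⟨ +-comm (b * B) B ⟩
  suc b * B   ≤⟨ *-monoˡ-≤ B b<b' ⟩
  b' * B      ≤⟨ m≤m+n (b' * B) r' ⟩
  b' * B + r' ∎
  where open ≤-Reasoning

lex-≤⁻ : ∀ {B b b' r r'} → b * B + r ≤ b' * B + r' → r' < B → b ≤ b'
lex-≤⁻ le r'<B = ≮⇒≥ (λ b'<b → <⇒≱ (lex-< b'<b r'<B) le)

orient : ℕ → Bool → ℕ → ℕ
orient N false x = x
orient N true x = N ∸ x

Precedes : Bool → ℕ → ℕ → Set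
Precedes false x y = x < y
Precedes true x y = y < x

module _ {N : ℕ} where

  orient≤ : ∀ b {x} → x ≤ N → orient N b x ≤ N
  orient≤ false x≤N = x≤N
  orient≤ true {x} _ = m∸n≤m N x

  orient-injective : ∀ b {x y} → x ≤ N → y ≤ N → orient N b x ≡ orient N b y → x ≡ y
  orient-injective false _ _ eq = eq
  orient-injective true x≤N y≤N eq = ∸-cancelˡ-≡ x≤N y≤N eq

  orient-<⁻ : ∀ b {x y} → orient N b x < orient N b y → Precedes b x y
  orient-<⁻ false x<y = x<y
  orient-<⁻ true {x} {y} lt = ≰⇒> (λ x≤y → <⇒≱ lt (∸-monoʳ-≤ N x≤y))

Precedes⇒Between : ∀ b {x z y} → Precedes b x z → Precedes b z y → Between x z y
Precedes⇒Between false x<z z<y = inj₁ (x<z , z<y)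
Precedes⇒Between true z<x y<z = inj₂ (y<z , z<x)

Precedes-opposite : ∀ {b b'} {x y} → b ≢ b' → Precedes b x y → Precedes b' x y → ⊥
Precedes-opposite {false} {false} b≢b' _ _ = b≢b' refl
Precedes-opposite {false} {true} _ x<y y<x = <-asym x<y y<x
Precedes-opposite {true} {false} _ y<x x<y = <-asym x<y y<x
Precedes-opposite {true} {true} b≢b' _ _ = b≢b' refl

-- Out-of-range values are sent to an arbitrary page; only values below P are ever used.
toFin : ∀ {P} → 0 < P → ℕ → Fin P
toFin {P} 0<P x with x <? P
... | yes x<P = fromℕ< x<P
... | no _ = fromℕ< 0<P

toℕ-toFin : ∀ {P} (0<P : 0 < P) {x} → x < P → toℕ (toFin 0<P x) ≡ x
toℕ-toFin {P} 0<P {x} x<P with x <? P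
... | yes x<P' = toℕ-fromℕ< x<P'
... | no x≮P = ⊥-elim (x≮P x<P)

parity : ℕ → ℕ
parity 0 = 0
parity 1 = 1
parity (suc (suc n)) = parity n

parity≤1 : ∀ n → parity n ≤ 1
parity≤1 0 = z≤n
parity≤1 1 = ≤-refl
parity≤1 (suc (suc n)) = parity≤1 n

parity-suc : ∀ n → parity (suc n) ≢ parity n
parity-suc 0 ()
parity-suc 1 ()
parity-suc (suc (suc n)) = parity-suc n

-- Pages of P_k +_Q H: an H-edge with H-page p in row i goes to page hpage i p, the edge
-- v_j e_j to zpage, the edge v_{j+1} e_j to wpage, and the edge e_j e_{j+1} to parity j.
record PageScheme (k D : ℕ) : Set where
  field
    pages : ℕ
    hpage : ℕ → ℕ → ℕ
    zpage wpage : ℕ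
    pages>0 : 0 < pages
    hpage<pages : ∀ {i p} → i < k → p < D → hpage i p < pages
    zpage<pages : 2 ≤ k → zpage < pages
    wpage<pages : 2 ≤ k → wpage < pages
    parity<pages : 3 ≤ k → 1 < pages
    hpage-injective : ∀ {i i' p p'} → p < D → p' < D → hpage i p ≡ hpage i' p' → p ≡ p'
    zpage≢wpage : 2 ≤ k → zpage ≢ wpage
    zpage≢parity : ∀ {j} → 3 + j ≤ k → zpage ≢ parity j
    wpage≢parity : ∀ {j} → 3 + j ≤ k → wpage ≢ parity j
    zpage≢hpage : ∀ {j i p} → 2 + j ≤ k → i < k → p < D → i ≡ j ⊎ (1 ≤ j × j < i) → zpage ≢ hpage i p
    wpage≢hpage : ∀ {j i p} → 2 + j ≤ k → i < k → p < D → j < i → wpage ≢ hpage i p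

module Embedding {k : ℕ} (H : Graph) (simple : IsSimple H) (col : Fin (n H) → Bool)
                 (proper : ∀ u v → Edge H u v → col u ≢ col v) {D : ℕ} (EH : MBE H D) (σ : PageScheme k D) where
  open PathQ k
  open QSum k H
  open ColumnLayout k
  open PageScheme σ
  module EH = MBE EH

  B : ℕ
  B = suc (suc K)

  inner : S → ℕ
  inner (a , h) = orient (suc K) (col h) (offset a)

  position : S → ℕ
  position s = EH.pos (proj₂ s) * B + inner s

  inner<B : ∀ s → inner s < B
  inner<B (a , h) = s≤s (orient≤ (col h) (offset≤1+K a))

  position-injective : ∀ {s t} → position s ≡ position t → s ≡ t
  position-injective {a , h} {b , g} eq with EH.pos-inj h g (≤-antisym
      (lex-≤⁻ (≤-reflexive eq) (inner<B (b , g))) (lex-≤⁻ (≤-reflexive (sym eq)) (inner<B (a , h))))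
  ... | refl = cong (_, h) (offset-injective (orient-injective (col h) (offset≤1+K a) (offset≤1+K b)
                 (+-cancelˡ-≡ (EH.pos h * B) _ _ eq)))

  -- A record rather than a synonym, so that s and t can be inferred from a proof.
  record _≺_ (s t : S) : Set where
    constructor spine<
    field position< : position s < position t

  block-≤ : ∀ {s t} → s ≺ t → EH.pos (proj₂ s) ≤ EH.pos (proj₂ t)
  block-≤ {t = t} (spine< s<t) = lex-≤⁻ (<⇒≤ s<t) (inner<B t)

  squeeze : ∀ {a b h z} → (a , h) ≺ z → z ≺ (b , h) → proj₂ z ≡ h
  squeeze s≺z z≺t = EH.pos-inj _ _ (≤-antisym (block-≤ z≺t) (block-≤ s≺z))

  in-block : ∀ {a c h} → (a , h) ≺ (c , h) → Precedes (col h) (offset a) (offset c)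
  in-block {h = h} (spine< lt) = orient-<⁻ (col h) (+-cancelˡ-< (EH.pos h * B) _ _ lt)

  between-in-block : ∀ {a b c h} → (a , h) ≺ (c , h) → (c , h) ≺ (b , h) → Between (offset a) (offset c) (offset b)
  between-in-block {h = h} a≺c c≺b = Precedes⇒Between (col h) (in-block a≺c) (in-block c≺b)

  zigzagPage : ℕ → ℕ → ℕ
  zigzagPage zero zero = zpage
  zigzagPage (suc i) (suc j) = zigzagPage i j
  zigzagPage _ _ = wpage

  columnPage : Cell → Cell → ℕ
  columnPage (inj₁ u) (inj₂ e) = zigzagPage (toℕ u) (lo e)
  columnPage (inj₂ e) (inj₁ u) = zigzagPage (toℕ u) (lo e)
  columnPage (inj₂ e) (inj₂ f) = parity (lo e ⊓ lo f)
  columnPage (inj₁ _) (inj₁ _) = 0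

  linkPage : S → S → ℕ
  linkPage (inj₁ u , h) (inj₁ _ , g) = hpage (toℕ u) (toℕ (EH.page h g))
  linkPage (a , _) (b , _) = columnPage a b

  linkPage-column : ∀ {a b h g} → QEdge a b → linkPage (a , h) (b , g) ≡ columnPage a b
  linkPage-column (vertex-edge _) = refl
  linkPage-column (edge-vertex _) = refl
  linkPage-column (edge-next _) = refl
  linkPage-column (edge-prev _) = refl

  private
    zigzagPage-lower : ∀ {i j} → i ≡ j → zigzagPage i j ≡ zpage
    zigzagPage-lower {zero} refl = refl
    zigzagPage-lower {suc i} refl = zigzagPage-lower {i} refl

    zigzagPage-upper : ∀ {i j} → i ≡ suc j → zigzagPage i j ≡ wpage
    zigzagPage-upper {j = zero} refl = refl
    zigzagPage-upper {j = suc j} refl = zigzagPage-upper {j = j} refl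

    2≤k : PEdge → 2 ≤ k
    2≤k e = ≤-trans (s≤s (s≤s z≤n)) (lo+2≤k e)

    next-3+lo≤k : ∀ {e f} → lo f ≡ suc (lo e) → 3 + lo e ≤ k
    next-3+lo≤k {f = f} next = subst (λ j → 2 + j ≤ k) next (lo+2≤k f)

    next-parity : ∀ {e f} → lo f ≡ suc (lo e) → parity (lo e ⊓ lo f) ≡ parity (lo e)
    next-parity next = cong parity (m≤n⇒m⊓n≡m (≤-trans (n≤1+n _) (≤-reflexive (sym next))))

    prev-parity : ∀ {e f} → lo e ≡ suc (lo f) → parity (lo e ⊓ lo f) ≡ parity (lo f)
    prev-parity prev = cong parity (m≥n⇒m⊓n≡n (≤-trans (n≤1+n _) (≤-reflexive (sym prev))))

  zigzagPage<pages : ∀ {u e} → Incident u e → zigzagPage (toℕ u) (lo e) < pages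
  zigzagPage<pages {e = e} (lower u≡lo) = subst (_< pages) (sym (zigzagPage-lower u≡lo)) (zpage<pages (2≤k e))
  zigzagPage<pages {e = e} (upper u≡hi) = subst (_< pages) (sym (zigzagPage-upper u≡hi)) (wpage<pages (2≤k e))

  linkPage<pages : ∀ {s t} → Link s t → linkPage s t < pages
  linkPage<pages (row u {h} {g} _) = hpage<pages (toℕ<n u) (toℕ<n (EH.page h g))
  linkPage<pages (column _ (vertex-edge u∈e)) = zigzagPage<pages u∈e
  linkPage<pages (column _ (edge-vertex u∈e)) = zigzagPage<pages u∈e
  linkPage<pages (column _ (edge-next {e} {f} next)) =
    ≤-<-trans (parity≤1 (lo e ⊓ lo f)) (parity<pages (≤-trans (s≤s (s≤s (s≤s z≤n))) (next-3+lo≤k next)))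
  linkPage<pages (column _ (edge-prev {e} {f} prev)) =
    ≤-<-trans (parity≤1 (lo e ⊓ lo f)) (parity<pages (≤-trans (s≤s (s≤s (s≤s z≤n))) (next-3+lo≤k prev)))

  linkPage-sym : ∀ {s t} → Link s t → linkPage s t ≡ linkPage t s
  linkPage-sym (row u {h} {g} hg) = cong (hpage (toℕ u) ∘ toℕ) (EH.page-sym h g hg)
  linkPage-sym (column _ (vertex-edge _)) = refl
  linkPage-sym (column _ (edge-vertex _)) = refl
  linkPage-sym (column _ (edge-next {e} {f} _)) = cong parity (⊓-comm (lo e) (lo f))
  linkPage-sym (column _ (edge-prev {e} {f} _)) = cong parity (⊓-comm (lo e) (lo f))

  -- The two cases: row w is the vertex end of the zigzag edge, or lies strictly under it.
  zigzagPage≢hpage : ∀ {u e w p} → Incident u e → toℕ w ≡ toℕ u ⊎ (1 ≤ toℕ u × toℕ u < toℕ w) → p < D →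
                     zigzagPage (toℕ u) (lo e) ≢ hpage (toℕ w) p
  zigzagPage≢hpage {u} {e} {w} (lower u≡lo) w-over p<D =
    zpage≢hpage (lo+2≤k e) (toℕ<n w) p<D w-over′ ∘ trans (sym (zigzagPage-lower u≡lo))
    where
    w-over′ : toℕ w ≡ lo e ⊎ (1 ≤ lo e × lo e < toℕ w)
    w-over′ = subst (λ j → toℕ w ≡ j ⊎ (1 ≤ j × j < toℕ w)) u≡lo w-over
  zigzagPage≢hpage {u} {e} {w} (upper u≡hi) w-over p<D =
    wpage≢hpage (lo+2≤k e) (toℕ<n w) p<D (lo<w w-over) ∘ trans (sym (zigzagPage-upper u≡hi))
    where
    lo<w : toℕ w ≡ toℕ u ⊎ (1 ≤ toℕ u × toℕ u < toℕ w) → lo e < toℕ w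
    lo<w (inj₁ w≡u) = ≤-reflexive (sym (trans w≡u u≡hi))
    lo<w (inj₂ (_ , u<w)) = <-trans (≤-reflexive (sym u≡hi)) u<w

  columnPage≢hpage : ∀ {a b w p} → QEdge a b → Between (offset a) (offset (inj₁ w)) (offset b) → p < D →
                      columnPage a b ≢ hpage (toℕ w) p
  columnPage≢hpage (vertex-edge {e = e} u∈e) inside = zigzagPage≢hpage u∈e (inj₂ (passes-over u∈e inside))
    where
    passes-over : ∀ {u w} → Incident u e → Between (vertexOffset (toℕ u)) (vertexOffset (toℕ w)) (K ∸ lo e) →
                  1 ≤ toℕ u × toℕ u < toℕ w
    passes-over {w = w} (lower u≡lo) = row-inside-zigzag (≤-trans (≤-reflexive u≡lo) (n≤1+n _)) (lo+2≤k e) (toℕ<n w)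
    passes-over {w = w} (upper u≡hi) = row-inside-zigzag (≤-reflexive u≡hi) (lo+2≤k e) (toℕ<n w)
  columnPage≢hpage (edge-vertex u∈e) inside = columnPage≢hpage (vertex-edge u∈e) (Between-sym inside)
  columnPage≢hpage (edge-next next) inside = ⊥-elim (adjacent-empty (inj₁ (next-adjacent next)) inside)
  columnPage≢hpage (edge-prev prev) inside = ⊥-elim (adjacent-empty (inj₂ (next-adjacent prev)) inside)

  private
    same-zigzag-kind : ∀ {u u' e e'} → Incident u e → Incident u' e' →
                       zigzagPage (toℕ u) (lo e) ≡ zigzagPage (toℕ u') (lo e') →
                       (toℕ u ≡ lo e × toℕ u' ≡ lo e') ⊎ (toℕ u ≡ suc (lo e) × toℕ u' ≡ suc (lo e'))
    same-zigzag-kind (lower u≡lo) (lower u'≡lo') _ = inj₁ (u≡lo , u'≡lo')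
    same-zigzag-kind (upper u≡hi) (upper u'≡hi') _ = inj₂ (u≡hi , u'≡hi')
    same-zigzag-kind {e = e} (lower u≡lo) (upper u'≡hi') eq =
      ⊥-elim (zpage≢wpage (2≤k e) (trans (sym (zigzagPage-lower u≡lo)) (trans eq (zigzagPage-upper u'≡hi'))))
    same-zigzag-kind {e = e} (upper u≡hi) (lower u'≡lo') eq =
      ⊥-elim (zpage≢wpage (2≤k e) (trans (sym (zigzagPage-lower u'≡lo')) (trans (sym eq) (zigzagPage-upper u≡hi))))

    zigzagPage≢parity : ∀ {u e j} → Incident u e → 3 + j ≤ k → zigzagPage (toℕ u) (lo e) ≢ parity j
    zigzagPage≢parity (lower u≡lo) bound = zpage≢parity bound ∘ trans (sym (zigzagPage-lower u≡lo))
    zigzagPage≢parity (upper u≡hi) bound = wpage≢parity bound ∘ trans (sym (zigzagPage-upper u≡hi))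

  columnPage-matching : ∀ {a b b'} → QEdge a b → QEdge a b' → columnPage a b ≡ columnPage a b' → b ≡ b'
  columnPage-matching (vertex-edge u∈e) (vertex-edge u∈e') eq with same-zigzag-kind u∈e u∈e' eq
  ... | inj₁ (u≡lo , u≡lo') = cong inj₂ (lo-injective (trans (sym u≡lo) u≡lo'))
  ... | inj₂ (u≡hi , u≡hi') = cong inj₂ (lo-injective (suc-injective (trans (sym u≡hi) u≡hi')))
  columnPage-matching (edge-vertex u∈e) (edge-vertex u'∈e) eq with same-zigzag-kind u∈e u'∈e eq
  ... | inj₁ (u≡lo , u'≡lo) = cong inj₁ (toℕ-injective (trans u≡lo (sym u'≡lo)))
  ... | inj₂ (u≡hi , u'≡hi) = cong inj₁ (toℕ-injective (trans u≡hi (sym u'≡hi)))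
  columnPage-matching (edge-vertex u∈e) (edge-next next) eq =
    ⊥-elim (zigzagPage≢parity u∈e (next-3+lo≤k next) (trans eq (next-parity next)))
  columnPage-matching (edge-vertex u∈e) (edge-prev prev) eq =
    ⊥-elim (zigzagPage≢parity u∈e (next-3+lo≤k prev) (trans eq (prev-parity prev)))
  columnPage-matching (edge-next next) (edge-vertex u∈e) eq =
    ⊥-elim (zigzagPage≢parity u∈e (next-3+lo≤k next) (trans (sym eq) (next-parity next)))
  columnPage-matching (edge-prev prev) (edge-vertex u∈e) eq =
    ⊥-elim (zigzagPage≢parity u∈e (next-3+lo≤k prev) (trans (sym eq) (prev-parity prev)))
  columnPage-matching (edge-next next) (edge-next next') _ = cong inj₂ (lo-injective (trans next (sym next')))
  columnPage-matching (edge-prev prev) (edge-prev prev') _ = cong inj₂ (lo-injective (suc-injective (trans (sym prev) prev')))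
  columnPage-matching (edge-next next) (edge-prev {f = f'} prev) eq =
    ⊥-elim (parity-suc (lo f') (trans (cong parity (sym prev))
                                      (trans (sym (next-parity next)) (trans eq (prev-parity prev)))))
  columnPage-matching (edge-prev {f = f} prev) (edge-next next) eq =
    ⊥-elim (parity-suc (lo f) (trans (cong parity (sym prev))
                                     (trans (sym (next-parity next)) (trans (sym eq) (prev-parity prev)))))

  linkPage-matching : ∀ {s t t'} → Link s t → Link s t' → linkPage s t ≡ linkPage s t' → t ≡ t'
  linkPage-matching (row u {h} {g} hg) (row _ {g = g'} hg') eq =
    cong (inj₁ u ,_) (EH.matching h g g' hg hg' (toℕ-injective (hpage-injective (toℕ<n _) (toℕ<n _) eq)))
  linkPage-matching (row u {h} {g} _) (column _ (vertex-edge u∈e)) eq =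
    ⊥-elim (zigzagPage≢hpage u∈e (inj₁ refl) (toℕ<n (EH.page h g)) (sym eq))
  linkPage-matching (column h (vertex-edge u∈e)) (row _ {g = g} _) eq =
    ⊥-elim (zigzagPage≢hpage u∈e (inj₁ refl) (toℕ<n (EH.page h g)) eq)
  linkPage-matching (column h q) (column _ q') eq =
    cong (_, h) (columnPage-matching q q' (trans (sym (linkPage-column q)) (trans eq (linkPage-column q'))))

  links-noncrossing : ∀ {s t s' t'} → Link s t → Link s' t' → linkPage s t ≡ linkPage s' t' →
                      s ≺ s' → s' ≺ t → t ≺ t' → ⊥
  links-noncrossing (row u {h} {g} hg) (row u' {h'} {g'} h'g') eq s≺s' s'≺t t≺t'
    with interleaved⇒same-edge simple EH hg h'g' (toℕ-injective (hpage-injective (toℕ<n _) (toℕ<n _) eq))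
           (block-≤ s≺s') (block-≤ s'≺t) (block-≤ t≺t')
  ... | refl , refl = Precedes-opposite (proper h g hg) (in-block s≺s') (in-block t≺t')
  links-noncrossing (row u {h} {g} _) (column _ q') eq _ s'≺t t≺t' with refl ← squeeze s'≺t t≺t' =
    columnPage≢hpage q' (between-in-block s'≺t t≺t') (toℕ<n (EH.page h g)) (trans (sym (linkPage-column q')) (sym eq))
  links-noncrossing (column _ q) (row _ {g} {g'} _) eq s≺s' s'≺t _ with refl ← squeeze s≺s' s'≺t =
    columnPage≢hpage q (between-in-block s≺s' s'≺t) (toℕ<n (EH.page g g')) (trans (sym (linkPage-column q)) eq)
  links-noncrossing (column _ q) (column _ q') _ s≺s' s'≺t t≺t' with refl ← squeeze s≺s' s'≺t =
    spans-noncrossing (span q) (span q') (between-in-block s≺s' s'≺t) (between-in-block s'≺t t≺t')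

  embedding : MBE G pages
  embedding = record
    { pos = position ∘ decodeS
    ; pos-inj = λ _ _ eq → decode-injective (position-injective eq)
    ; page = page
    ; page-sym = λ _ _ xy → cong (toFin pages>0) (linkPage-sym (Edge⇒Link xy))
    ; matching = λ _ _ _ xy xz eq →
                   decode-injective (linkPage-matching (Edge⇒Link xy) (Edge⇒Link xz) (page-cancel xy xz eq))
    ; noCross = λ _ _ _ _ ab cd eq (a<c , c<b , b<d) →
                  links-noncrossing (Edge⇒Link ab) (Edge⇒Link cd) (page-cancel ab cd eq)
                                    (spine< a<c) (spine< c<b) (spine< b<d)
    }
    where
    page : Fin (n G) → Fin (n G) → Fin pages
    page x y = toFin pages>0 (linkPage (decodeS x) (decodeS y))
    page-cancel : ∀ {x y x' y'} → Edge G x y → Edge G x' y' → page x y ≡ page x' y' →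
                  linkPage (decodeS x) (decodeS y) ≡ linkPage (decodeS x') (decodeS y')
    page-cancel xy x'y' eq = trans (sym (toℕ-toFin pages>0 (linkPage<pages (Edge⇒Link xy))))
                                   (trans (cong toℕ eq) (toℕ-toFin pages>0 (linkPage<pages (Edge⇒Link x'y'))))

-- P₁ has no edges.
singleRowScheme : ∀ {D} → 0 < D → PageScheme 1 D
singleRowScheme {D} 0<D = record
  { pages = D ; hpage = λ _ p → p ; zpage = 0 ; wpage = 0 ; pages>0 = 0<D
  ; hpage<pages = λ _ p<D → p<D
  ; zpage<pages = λ { (s≤s ()) } ; wpage<pages = λ { (s≤s ()) } ; parity<pages = λ { (s≤s ()) }
  ; hpage-injective = λ _ _ eq → eq
  ; zpage≢wpage = λ { (s≤s ()) } ; zpage≢parity = λ { (s≤s ()) } ; wpage≢parity = λ { (s≤s ()) }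
  ; zpage≢hpage = λ { (s≤s ()) } ; wpage≢hpage = λ { (s≤s ()) }
  }

-- Both v₀e₀ and v₁e₀ want the one spare page D, so row 1 hands its H-page 0 over to D.
twoRowScheme : ∀ {D} → 0 < D → PageScheme 2 D
twoRowScheme {D} 0<D = record
  { pages = suc D ; hpage = hpage ; zpage = D ; wpage = 0 ; pages>0 = s≤s z≤n
  ; hpage<pages = λ {i} {p} _ p<D → [ (λ eq → subst (_< suc D) (sym eq) (<-trans p<D (n<1+n D)))
                                     , (λ { (_ , eq) → subst (_< suc D) (sym eq) (n<1+n D) }) ]′ (hpage-cases i p)
  ; zpage<pages = λ _ → n<1+n D ; wpage<pages = λ _ → s≤s z≤n ; parity<pages = λ { (s≤s (s≤s ())) }
  ; hpage-injective = hpage-injective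
  ; zpage≢wpage = λ _ D≡0 → <-irrefl (sym D≡0) 0<D
  ; zpage≢parity = λ { (s≤s (s≤s ())) } ; wpage≢parity = λ { (s≤s (s≤s ())) }
  ; zpage≢hpage = zpage≢hpage ; wpage≢hpage = wpage≢hpage
  }
  where
  hpage : ℕ → ℕ → ℕ
  hpage 1 0 = D
  hpage _ p = p

  hpage-cases : ∀ i p → hpage i p ≡ p ⊎ (p ≡ 0 × hpage i p ≡ D)
  hpage-cases 0 p = inj₁ refl
  hpage-cases 1 0 = inj₂ (refl , refl)
  hpage-cases 1 (suc p) = inj₁ refl
  hpage-cases (suc (suc i)) p = inj₁ refl

  hpage-injective : ∀ {i i' p p'} → p < D → p' < D → hpage i p ≡ hpage i' p' → p ≡ p'
  hpage-injective {i} {i'} {p} {p'} p<D p'<D eq with hpage-cases i p | hpage-cases i' p'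
  ... | inj₁ a | inj₁ b = trans (sym a) (trans eq b)
  ... | inj₁ a | inj₂ (_ , b) = ⊥-elim (<-irrefl (trans (sym a) (trans eq b)) p<D)
  ... | inj₂ (_ , a) | inj₁ b = ⊥-elim (<-irrefl (trans (sym b) (trans (sym eq) a)) p'<D)
  ... | inj₂ (p≡0 , _) | inj₂ (p'≡0 , _) = trans p≡0 (sym p'≡0)

  zpage≢hpage : ∀ {j i p} → 2 + j ≤ 2 → i < 2 → p < D → i ≡ j ⊎ (1 ≤ j × j < i) → D ≢ hpage i p
  zpage≢hpage {0} _ _ p<D (inj₁ refl) D≡p = <-irrefl (sym D≡p) p<D
  zpage≢hpage {0} _ _ _ (inj₂ (() , _))
  zpage≢hpage {suc _} (s≤s (s≤s ()))

  wpage≢hpage : ∀ {j i p} → 2 + j ≤ 2 → i < 2 → p < D → j < i → 0 ≢ hpage i p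
  wpage≢hpage {0} {1} {0} _ _ _ _ 0≡D = <-irrefl 0≡D 0<D
  wpage≢hpage {0} {1} {suc _} _ _ _ _ ()
  wpage≢hpage {0} {suc (suc _)} _ (s≤s (s≤s ()))
  wpage≢hpage {suc _} (s≤s (s≤s ()))

uniformScheme : ∀ {k D} d → D ≤ d → 1 ≤ d → (4 ≤ k → 2 ≤ d) → PageScheme k D
uniformScheme {k} {D} d D≤d 1≤d 4≤k⇒2≤d = record
  { pages = 2 + d ; hpage = λ _ p → p ; zpage = d ; wpage = suc d ; pages>0 = s≤s z≤n
  ; hpage<pages = λ _ p<D → <-≤-trans p<D (≤-trans D≤d (≤-trans (n≤1+n d) (n≤1+n (suc d))))
  ; zpage<pages = λ _ → ≤-trans (n<1+n d) (n≤1+n (suc d)) ; wpage<pages = λ _ → n<1+n (suc d)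
  ; parity<pages = λ _ → s≤s (s≤s z≤n)
  ; hpage-injective = λ _ _ eq → eq
  ; zpage≢wpage = λ _ d≡1+d → 1+n≢n (sym d≡1+d)
  ; zpage≢parity = zpage≢parity
  ; wpage≢parity = λ {j} _ eq → <⇒≱ (s≤s 1≤d) (subst (_≤ 1) (sym eq) (parity≤1 j))
  ; zpage≢hpage = λ _ _ p<D _ d≡p → <⇒≱ p<D (subst (D ≤_) d≡p D≤d)
  ; wpage≢hpage = λ _ _ p<D _ 1+d≡p → <⇒≱ p<D (subst (D ≤_) 1+d≡p (≤-trans D≤d (n≤1+n d)))
  }
  where
  zpage≢parity : ∀ {j} → 3 + j ≤ k → d ≢ parity j
  zpage≢parity {0} _ d≡0 = <-irrefl (sym d≡0) 1≤d
  zpage≢parity {suc j} 4+j≤k d≡parity =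
    <⇒≱ (4≤k⇒2≤d (≤-trans (s≤s (s≤s (s≤s (s≤s z≤n)))) 4+j≤k)) (subst (_≤ 1) (sym d≡parity) (parity≤1 (suc j)))

pageScheme : ∀ k → 1 ≤ k → ∀ {D} → 0 < D → PageScheme k D
pageScheme 1 _ 0<D = singleRowScheme 0<D
pageScheme 2 _ 0<D = twoRowScheme 0<D
pageScheme 3 _ {D} 0<D = uniformScheme D ≤-refl 0<D (λ { (s≤s (s≤s (s≤s ()))) })
pageScheme (suc (suc (suc (suc _)))) _ {D} _ =
  uniformScheme (D ⊔ 2) (m≤m⊔n D 2) (≤-trans (s≤s z≤n) (m≤n⊔m D 2)) (λ _ → m≤n⊔m D 2)

module Degrees (k : ℕ) (H : Graph) where
  open PathQ k
  open QSum k H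

  private
    encode-injective : ∀ {s t} → encode s ≡ encode t → s ≡ t
    encode-injective {s} {t} eq = trans (sym (decode-encode s)) (trans (cong decodeS eq) (decode-encode t))

    links≤Δ : ∀ s {ts} → Unique ts → All (Link s) ts → length ts ≤ Δ G
    links≤Δ s {ts} ts! links = begin
      length ts              ≡⟨ length-map encode ts ⟨
      length (map encode ts) ≤⟨ ≤deg G (encode s) (map⁺ encode-injective ts!) (All.map⁺ (All.map Link⇒Edge links)) ⟩
      deg G (encode s)       ≤⟨ deg≤Δ G (encode s) ⟩
      Δ G                    ∎
      where open ≤-Reasoning

  column-degree : ∀ a h {cs} → Unique cs → All (QEdge a) cs → length cs ≤ Δ G
  column-degree a h {cs} cs! adjacent =
    subst (_≤ Δ G) (length-map (_, h) cs) (links≤Δ (a , h) (map⁺ (cong proj₁) cs!) (All.map⁺ (All.map (column h) adjacent)))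

  vertex-degree : ∀ u h {cs} → Unique cs → All (QEdge (inj₁ u)) cs → length cs + deg H h ≤ Δ G
  vertex-degree u h {cs} cs! adjacent = subst (_≤ Δ G) size (links≤Δ (inj₁ u , h) unique links)
    where
    at-row : Fin (n H) → S
    at-row g = inj₁ u , g
    in-column in-row : List S
    in-column = map (_, h) cs
    in-row = map at-row (neighbours H h)
    disjoint : ∀ {v} → ¬ (v ∈ in-column × v ∈ in-row)
    disjoint (v∈column , v∈row) with ∈-map⁻ (_, h) v∈column | ∈-map⁻ at-row v∈row
    ... | c , c∈cs , refl | _ , _ , c,h≡u,g with subst (QEdge (inj₁ u)) (cong proj₁ c,h≡u,g) (All.lookup adjacent c∈cs)
    ...   | ()
    unique : Unique (in-column ++ in-row)
    unique = ++⁺ (map⁺ (cong proj₁) cs!) (map⁺ (cong proj₂) (neighbours-unique H h)) disjoint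
    links : All (Link (inj₁ u , h)) (in-column ++ in-row)
    links = All.++⁺ (All.map⁺ (All.map (column h) adjacent))
                    (All.map⁺ (All.tabulate (λ g∈ → row u (∈-neighbours⁻ H h g∈))))
    size : length (in-column ++ in-row) ≡ length cs + deg H h
    size = trans (length-++ in-column) (cong₂ _+_ (length-map (_, h) cs) (length-map at-row (neighbours H h)))

  module _ (h : Fin (n H)) where
    private
      differ : ∀ {x y m m' : ℕ} → x ≡ m → y ≡ m' → m ≢ m' → x ≢ y
      differ refl refl m≢m' = m≢m'

      vertices-differ : ∀ {u u' : Fin k} → toℕ u ≢ toℕ u' → _≢_ {A = Cell} (inj₁ u) (inj₁ u')
      vertices-differ ne refl = ne refl

      edges-differ : ∀ {f f'} → lo f ≢ lo f' → _≢_ {A = Cell} (inj₂ f) (inj₂ f')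
      edges-differ ne refl = ne refl

      edge : ∀ {j} → 2 + j ≤ k → PEdge
      edge = proj₁ ∘ edge-at

      lo-edge : ∀ {j} (b : 2 + j ≤ k) → lo (edge b) ≡ j
      lo-edge = proj₂ ∘ edge-at

    row-degree : 1 ≤ k → deg H h ≤ Δ G
    row-degree 0<k = vertex-degree (fromℕ< 0<k) h [] []

    v₀-degree : 2 ≤ k → 1 + deg H h ≤ Δ G
    v₀-degree 2≤k = vertex-degree (fromℕ< 0<k) h ([] ∷ [])
                      (vertex-edge (lower (trans (toℕ-fromℕ< 0<k) (sym (lo-edge 2≤k)))) ∷ [])
      where 0<k = ≤-trans (s≤s z≤n) 2≤k

    v₁-degree : 3 ≤ k → 2 + deg H h ≤ Δ G
    v₁-degree 3≤k = vertex-degree v₁ h ((edges-differ (differ (lo-edge 2≤k) (lo-edge 3≤k) (λ ())) ∷ []) ∷ [] ∷ [])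
                      (vertex-edge (upper (trans (toℕ-fromℕ< 2≤k) (cong suc (sym (lo-edge 2≤k))))) ∷
                       vertex-edge (lower (trans (toℕ-fromℕ< 2≤k) (sym (lo-edge 3≤k)))) ∷ [])
      where
      2≤k = ≤-trans (s≤s (s≤s z≤n)) 3≤k
      v₁ = fromℕ< 2≤k

    e₁-degree : 4 ≤ k → 4 ≤ Δ G
    e₁-degree 4≤k = column-degree (inj₂ e₁) h
      ((vertices-differ (differ (toℕ-fromℕ< 2≤k) (toℕ-fromℕ< 3≤k) (λ ())) ∷ (λ ()) ∷ (λ ()) ∷ []) ∷
       ((λ ()) ∷ (λ ()) ∷ []) ∷ (edges-differ (differ (lo-edge 2≤k) (lo-edge 4≤k) (λ ())) ∷ []) ∷ [] ∷ [])
      (edge-vertex (lower (trans (toℕ-fromℕ< 2≤k) (sym (lo-edge 3≤k)))) ∷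
       edge-vertex (upper (trans (toℕ-fromℕ< 3≤k) (cong suc (sym (lo-edge 3≤k))))) ∷
       edge-prev (trans (lo-edge 3≤k) (cong suc (sym (lo-edge 2≤k)))) ∷
       edge-next (trans (lo-edge 4≤k) (cong suc (sym (lo-edge 3≤k)))) ∷ [])
      where
      3≤k = ≤-trans (n≤1+n 3) 4≤k
      2≤k = ≤-trans (n≤1+n 2) 3≤k
      e₁ = edge 3≤k

pages≤Δ : ∀ k (1≤k : 1 ≤ k) H (h : Fin (n H)) {D} (0<D : 0 < D) → D ≤ deg H h →
          PageScheme.pages (pageScheme k 1≤k 0<D) ≤ Δ (Path k +Q H)
pages≤Δ 1 _ H h _ D≤deg = ≤-trans D≤deg (Degrees.row-degree 1 H h ≤-refl)
pages≤Δ 2 _ H h _ D≤deg = ≤-trans (s≤s D≤deg) (Degrees.v₀-degree 2 H h ≤-refl)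
pages≤Δ 3 _ H h _ D≤deg = ≤-trans (+-monoʳ-≤ 2 D≤deg) (Degrees.v₁-degree 3 H h ≤-refl)
pages≤Δ k@(suc (suc (suc (suc _)))) _ H h {D} _ D≤deg = subst (_≤ Δ (Path k +Q H)) (sym (+-distribˡ-⊔ 2 D 2))
  (⊔-lub (≤-trans (+-monoʳ-≤ 2 D≤deg) (Degrees.v₁-degree k H h (s≤s (s≤s (s≤s z≤n)))))
         (Degrees.e₁-degree k H h (s≤s (s≤s (s≤s (s≤s z≤n))))))

Fin-inhabited? : ∀ m → Fin m ⊎ ¬ Fin m
Fin-inhabited? zero = inj₂ λ ()
Fin-inhabited? (suc m) = inj₁ fzero

theorem3p4 : (k : ℕ) → 1 ≤ k → (H : Graph) → IsSimple H → IsBipartite H → Dispersable H →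
    Dispersable (Path k +Q H)
theorem3p4 k 1≤k H simple (col , proper) (EH , _) with Fin-inhabited? (n H)
... | inj₂ no-vertex = dispersable-empty (Path k +Q H) (no-vertex ∘ proj₂ ∘ decode (Path k) H)
... | inj₁ h₀ with Δ-attained H h₀
...   | h , Δ≤deg =
  let 0<Δ = ≤-<-trans z≤n (toℕ<n (MBE.page EH h h)) in
  dispersable (Path k +Q H) (Embedding.embedding H simple col proper EH (pageScheme k 1≤k 0<Δ))
              (pages≤Δ k 1≤k H h 0<Δ Δ≤deg)
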